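{- Let $k\geq 3$ be a constant, let $N\geq k-1$ be an integer and let $G$ be an abelian group with $|G|\geq N^{k-1+c}$ for some $c>0$. Let $\mathbf{A}=(\mathbf{a}_1,\ldots,\mathbf{a}_N)$ be a tuple of $N$ elements drawn uniformly with replacement from $G$. Define the random variables $\mathbf{X}_1=\sum_{i\in\mathbf{I}}\mathbf{a}_i$, where $\mathbf{I}\subseteq[N]$ is a uniformly random set of size $k-1$, and $\mathbf{X}_2$, uniformly random over the set $\{\sum_{i\in I}\mathbf{a}_i: I\subseteq[N],|I|=k-1\}$. Then the statistical distance between $(\mathbf{A},\mathbf{X}_1)$ and $(\mathbf{A},\mathbf{X}_2)$ is $O(1/\sqrt{N^c})$.
   Formalization: The exponent c in the hypothesis on |G| and in the bound $O(1/\sqrt{N^c})$ ranges over the positive rationals. -}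

module Defs where

open import Data.Nat as ℕ using (ℕ; zero; suc)
open import Data.Integer as ℤ using (ℤ; +_)
open import Data.Rational as ℚ using (ℚ; 0ℚ; 1ℚ)
open import Data.Bool using (Bool; true; false; if_then_else_)
open import Data.Fin using (Fin)
open import Data.Fin.Properties using (_≟_)
open import Data.Fin.Subset using (Subset; ∣_∣; inside; outside)
open import Data.Vec using (Vec; []; _∷_)
open import Data.List as List using (List; []; _∷_; _++_; map; concatMap; filter; length; allFin)
open import Relation.Nullary using (does)
open import Relation.Nullary.Decidable using (⌊_⌋)
open import Algebra.Core using (Op₂)

_^ℚ_ : ℚ → ℕ → ℚ
q ^ℚ zero  = 1ℚ
q ^ℚ suc e = q ℚ.* (q ^ℚ e)

-- a / d as a rational; the denominator 0 case is a dummy (never used: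
-- all denominators below are positive in the situation of the theorem)
frac : ℕ → ℕ → ℚ
frac a zero    = 0ℚ
frac a (suc d) = (+ a) ℚ./ suc d

sumℚ : {A : Set} → List A → (A → ℚ) → ℚ
sumℚ []       f = 0ℚ
sumℚ (x ∷ xs) f = f x ℚ.+ sumℚ xs f

allTuples : (N n : ℕ) → List (Vec (Fin n) N)
allTuples zero    n = [] ∷ []
allTuples (suc N) n = concatMap (λ a → map (a ∷_) (allTuples N n)) (allFin n)

allSubsets : (N : ℕ) → List (Subset N)
allSubsets zero    = [] ∷ []
allSubsets (suc N) = map (inside ∷_) (allSubsets N) ++ map (outside ∷_) (allSubsets N)

subsetsOfSize : (N r : ℕ) → List (Subset N)
subsetsOfSize N r = filter (λ I → ∣ I ∣ ℕ.≟ r) (allSubsets N)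

subsetSum : {n N : ℕ} → Op₂ (Fin n) → Fin n → Vec (Fin n) N → Subset N → Fin n
subsetSum _∙_ ε []       []             = ε
subsetSum _∙_ ε (a ∷ as) (true  ∷ I)    = a ∙ subsetSum _∙_ ε as I
subsetSum _∙_ ε (a ∷ as) (false ∷ I)    = subsetSum _∙_ ε as I

multiplicity : {n N : ℕ} → Op₂ (Fin n) → Fin n → ℕ → Vec (Fin n) N → Fin n → ℕ
multiplicity {n} {N} _∙_ ε r A x =
  length (filter (λ I → subsetSum _∙_ ε A I ≟ x) (subsetsOfSize N r))

inSums : {n N : ℕ} → Op₂ (Fin n) → Fin n → ℕ → Vec (Fin n) N → Fin n → Bool
inSums _∙_ ε r A x with multiplicity _∙_ ε r A x
... | zero  = false
... | suc _ = true

numSums : {n N : ℕ} → Op₂ (Fin n) → Fin n → ℕ → Vec (Fin n) N → ℕ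
numSums {n} _∙_ ε r A = length (filter (λ x → inSums _∙_ ε r A x Data.Bool.≟ true) (allFin n))

-- Pr[(A, X₁) = (A, x)] = n^{-N} · m_A(x) / C(N, r)
--   (X₁ = Σ_{i∈I} a_i with I uniform among r-subsets of [N])
prob₁ : {n N : ℕ} → Op₂ (Fin n) → Fin n → ℕ → Vec (Fin n) N → Fin n → ℚ
prob₁ {n} {N} _∙_ ε r A x =
  frac 1 (n ℕ.^ N) ℚ.* frac (multiplicity _∙_ ε r A x) (length (subsetsOfSize N r))

-- Pr[(A, X₂) = (A, x)] = n^{-N} · [x ∈ S_A] / |S_A|
--   (X₂ uniform on S_A)
prob₂ : {n N : ℕ} → Op₂ (Fin n) → Fin n → ℕ → Vec (Fin n) N → Fin n → ℚ
prob₂ {n} {N} _∙_ ε r A x =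
  frac 1 (n ℕ.^ N) ℚ.*
  frac (if inSums _∙_ ε r A x then 1 else 0) (numSums _∙_ ε r A)

statDist : (n N : ℕ) → Op₂ (Fin n) → Fin n → ℕ → ℚ
statDist n N _∙_ ε r =
  ℚ.½ ℚ.* sumℚ (allTuples N n) (λ A →
            sumℚ (allFin n) (λ x → ℚ.∣ prob₁ _∙_ ε r A x ℚ.- prob₂ _∙_ ε r A x ∣))

module Submission where

-- Write r = k − 1, M = C(N, r), and for a tuple A let m_A(x) be the number of
-- r-subsets I with σ_A(I) = Σ_{i∈I} a_i = x.  Given A, X₁ has law m_A/M and X₂
-- is uniform on the support of m_A, of size S_A.  The proof has three steps.
--  * Profile inequality (module Profile): for any f with total mass T, support
--    size S and collision number D = Σ f(f−1),  Σ_x |f x/T − [f x > 0]/S| ≤ 2D/T.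
--  * Collision count (module Collisions): for subsets I ≠ J of [N], the event
--    σ_A(I) = σ_A(J) has probability exactly 1/n, since a coordinate in only one
--    of them is then determined by the others.  Hence E_A[D_A] ≤ M²/n.
--  * Assembly (module Distance): SD ≤ ½ · E_A[2D_A/M] ≤ M/n ≤ N^r/n, and
--    N^(rq+p) ≤ n^q turns this into SD^(2q) · N^p ≤ 1, so C = 1 works
--    (this is SD ≤ N^(−c) with c = p/q, stronger than the stated O(N^(−c/2))).

open import Defs
open import Data.Nat as ℕ using (ℕ; zero; suc; _≤_; _<_; _∸_; _+_; _*_; _^_; ∣_-_∣)
import Data.Nat.Properties as ℕP
open import Data.Nat.Solver using (module +-*-Solver)
open import Data.Integer as ℤ using (+_)
import Data.Integer.Properties as ℤP
open import Data.Rational as ℚ using (ℚ; 0ℚ; 1ℚ)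
import Data.Rational.Properties as ℚP
open import Data.Rational.Unnormalised as ℚᵘ using (ℚᵘ; mkℚᵘ)
import Data.Rational.Unnormalised.Properties as ℚᵘP
open import Data.Bool using (true; false; if_then_else_)
import Data.Bool as Bool
open import Data.Fin using (Fin)
import Data.Fin as Fin
open import Data.Fin.Properties using (_≟_)
open import Data.Fin.Subset using (Subset; ∣_∣)
open import Data.Vec using (Vec; []; _∷_)
open import Data.List using (List; []; _∷_; _++_; map; concatMap; filter; length; allFin)
import Data.List.Properties as ListP
open import Data.Product using (∃-syntax; _,_)
open import Data.Sum using (inj₁; inj₂)
open import Data.Empty using (⊥-elim)
open import Function using (_∘_)
open import Relation.Nullary using (Dec; yes; no)
open import Relation.Unary using (Decidable)
open import Relation.Binary.PropositionalEquality
open import Algebra.Core using (Op₁; Op₂)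
open import Algebra.Structures using (IsAbelianGroup; IsGroup)
open import Algebra.Bundles using (Group)
import Algebra.Properties.Group as GroupProperties
import Algebra.Properties.Quasigroup as QuasigroupProperties
open import Level using (0ℓ)

open +-*-Solver using (solve; _:+_; _:*_; _:=_; con)

-- Arithmetic of the fractions  frac a b = a / b  (with a / 0 := 0)

+-* : ∀ m n → + m ℤ.* + n ≡ + (m * n)
+-* m n = sym (ℤP.pos-* m n)

toℚᵘ-frac : ∀ a b → ℚ.toℚᵘ (frac a (suc b)) ℚᵘ.≃ mkℚᵘ (+ a) b
toℚᵘ-frac a b = ℚP.toℚᵘ-fromℚᵘ (mkℚᵘ (+ a) b)

≃-mkℚᵘ : ∀ (X : ℚᵘ) x c d → ℚᵘ.↥ X ≡ + x → x * suc d ≡ c * ℚᵘ.↧ₙ X →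
         X ℚᵘ.≃ mkℚᵘ (+ c) d
≃-mkℚᵘ X x c d ↥X≡x cross = ℚᵘ.*≡* (begin
  ℚᵘ.↥ X ℤ.* + suc d  ≡⟨ cong (ℤ._* + suc d) ↥X≡x ⟩
  + x ℤ.* + suc d     ≡⟨ +-* x (suc d) ⟩
  + (x * suc d)       ≡⟨ cong +_ cross ⟩
  + (c * ℚᵘ.↧ₙ X)     ≡⟨ +-* c (ℚᵘ.↧ₙ X) ⟨
  + c ℤ.* ℚᵘ.↧ X      ∎)
  where open ≡-Reasoning

frac-≡ : ∀ a b c d → a * suc d ≡ c * suc b → frac a (suc b) ≡ frac c (suc d)
frac-≡ a b c d cross = ℚP.toℚᵘ-injective
  (ℚᵘP.≃-trans (toℚᵘ-frac a b)
    (ℚᵘP.≃-trans (≃-mkℚᵘ (mkℚᵘ (+ a) b) a c d refl cross) (ℚᵘP.≃-sym (toℚᵘ-frac c d))))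

frac-≤-pos : ∀ a b c d → a * suc d ≤ c * suc b → frac a (suc b) ℚ.≤ frac c (suc d)
frac-≤-pos a b c d cross = ℚP.toℚᵘ-cancel-≤
  (ℚᵘP.≤-respˡ-≃ (ℚᵘP.≃-sym (toℚᵘ-frac a b))
    (ℚᵘP.≤-respʳ-≃ (ℚᵘP.≃-sym (toℚᵘ-frac c d)) (ℚᵘ.*≤* cross′)))
  where
  cross′ : + a ℤ.* + suc d ℤ.≤ + c ℤ.* + suc b
  cross′ = subst₂ ℤ._≤_ (sym (+-* a (suc d))) (sym (+-* c (suc b))) (ℤ.+≤+ cross)

frac-zero : ∀ b → frac 0 b ≡ 0ℚ
frac-zero zero    = refl
frac-zero (suc b) = frac-≡ 0 b 0 0 refl

frac-nonneg : ∀ a b → 0ℚ ℚ.≤ frac a b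
frac-nonneg a zero    = ℚP.≤-refl
frac-nonneg a (suc b) = frac-≤-pos 0 0 a b ℕ.z≤n

-- Comparison by cross multiplication for an arbitrary left denominator (a left
-- fraction with denominator 0 is 0) and a positive right denominator.
frac-≤ : ∀ a B c D .{{_ : ℕ.NonZero D}} → a * D ≤ c * B → frac a B ℚ.≤ frac c D
frac-≤ a zero    c (suc d) _     = frac-nonneg c (suc d)
frac-≤ a (suc b) c (suc d) cross = frac-≤-pos a b c d cross

frac-≤-1 : ∀ a b → a ≤ b → frac a b ℚ.≤ 1ℚ
frac-≤-1 a b a≤b = frac-≤ a b 1 1 (begin
  a * 1  ≡⟨ ℕP.*-identityʳ a ⟩
  a      ≤⟨ a≤b ⟩
  b      ≡⟨ ℕP.*-identityˡ b ⟨
  1 * b  ∎)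
  where open ℕP.≤-Reasoning

frac-+ : ∀ a b D → frac a D ℚ.+ frac b D ≡ frac (a + b) D
frac-+ a b zero    = ℚP.+-identityˡ 0ℚ
frac-+ a b (suc d) = ℚP.toℚᵘ-injective
  (ℚᵘP.≃-trans (ℚP.toℚᵘ-homo-+ (frac a (suc d)) (frac b (suc d)))
  (ℚᵘP.≃-trans (ℚᵘP.+-cong (toℚᵘ-frac a d) (toℚᵘ-frac b d))
  (ℚᵘP.≃-trans (≃-mkℚᵘ (mkℚᵘ (+ a) d ℚᵘ.+ mkℚᵘ (+ b) d) (a * suc d + b * suc d) (a + b) d
      (trans (cong₂ ℤ._+_ (+-* a (suc d)) (+-* b (suc d))) (sym (ℤP.pos-+ (a * suc d) (b * suc d))))
      (solve 3 (λ a b d → (a :* (con 1 :+ d) :+ b :* (con 1 :+ d)) :* (con 1 :+ d)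
                        := (a :+ b) :* ((con 1 :+ d) :* (con 1 :+ d))) refl a b d))
  (ℚᵘP.≃-sym (toℚᵘ-frac (a + b) d)))))

frac-* : ∀ a B c D → frac a B ℚ.* frac c D ≡ frac (a * c) (B * D)
frac-* a zero    c D       = ℚP.*-zeroˡ (frac c D)
frac-* a (suc b) c zero    = trans (ℚP.*-zeroʳ (frac a (suc b)))
                                   (cong (frac (a * c)) (sym (ℕP.*-zeroʳ (suc b))))
frac-* a (suc b) c (suc d) = ℚP.toℚᵘ-injective
  (ℚᵘP.≃-trans (ℚP.toℚᵘ-homo-* (frac a (suc b)) (frac c (suc d)))
  (ℚᵘP.≃-trans (ℚᵘP.*-cong (toℚᵘ-frac a b) (toℚᵘ-frac c d))
  (ℚᵘP.≃-trans (≃-mkℚᵘ (mkℚᵘ (+ a) b ℚᵘ.* mkℚᵘ (+ c) d) (a * c) (a * c) (d + b * suc d)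
                  (+-* a c) refl)
  (ℚᵘP.≃-sym (toℚᵘ-frac (a * c) (d + b * suc d))))))

frac-^ : ∀ a B e → frac a B ^ℚ e ≡ frac (a ^ e) (B ^ e)
frac-^ a B zero    = refl
frac-^ a B (suc e) = trans (cong (frac a B ℚ.*_) (frac-^ a B e)) (frac-* a B (a ^ e) (B ^ e))

∣frac-frac∣ : ∀ x y D → ℚ.∣ frac x D ℚ.- frac y D ∣ ≡ frac ∣ x - y ∣ D
∣frac-frac∣ x y D with ℕP.≤-total x y
... | inj₁ x≤y = begin
  ℚ.∣ frac x D ℚ.- frac y D ∣                 ≡⟨ cong (λ z → ℚ.∣ frac x D ℚ.- z ∣) y-split ⟩
  ℚ.∣ frac x D ℚ.- (frac x D ℚ.+ frac d D) ∣  ≡⟨ cong ℚ.∣_∣ (p-[p+q]≡-q (frac x D) (frac d D)) ⟩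
  ℚ.∣ ℚ.- frac d D ∣                          ≡⟨ ℚP.∣-p∣≡∣p∣ (frac d D) ⟩
  ℚ.∣ frac d D ∣                              ≡⟨ ℚP.0≤p⇒∣p∣≡p (frac-nonneg d D) ⟩
  frac d D                                    ≡⟨ cong (λ z → frac z D) (ℕP.m≤n⇒∣m-n∣≡n∸m x≤y) ⟨
  frac ∣ x - y ∣ D                            ∎
  where
  open ≡-Reasoning
  d = y ∸ x
  y-split : frac y D ≡ frac x D ℚ.+ frac d D
  y-split = trans (cong (λ z → frac z D) (sym (ℕP.m+[n∸m]≡n x≤y))) (sym (frac-+ x d D))
  p-[p+q]≡-q : ∀ p q → p ℚ.- (p ℚ.+ q) ≡ ℚ.- q
  p-[p+q]≡-q p q = begin
    p ℚ.+ ℚ.- (p ℚ.+ q)      ≡⟨ cong (p ℚ.+_) (ℚP.neg-distrib-+ p q) ⟩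
    p ℚ.+ (ℚ.- p ℚ.+ ℚ.- q)  ≡⟨ ℚP.+-assoc p (ℚ.- p) (ℚ.- q) ⟨
    (p ℚ.- p) ℚ.+ ℚ.- q      ≡⟨ cong (ℚ._+ ℚ.- q) (ℚP.+-inverseʳ p) ⟩
    0ℚ ℚ.+ ℚ.- q             ≡⟨ ℚP.+-identityˡ (ℚ.- q) ⟩
    ℚ.- q                    ∎
... | inj₂ y≤x = begin
  ℚ.∣ frac x D ℚ.- frac y D ∣                 ≡⟨ cong (λ z → ℚ.∣ z ℚ.- frac y D ∣) x-split ⟩
  ℚ.∣ (frac y D ℚ.+ frac d D) ℚ.- frac y D ∣  ≡⟨ cong ℚ.∣_∣ ([p+q]-p≡q (frac y D) (frac d D)) ⟩
  ℚ.∣ frac d D ∣                              ≡⟨ ℚP.0≤p⇒∣p∣≡p (frac-nonneg d D) ⟩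
  frac d D                                    ≡⟨ cong (λ z → frac z D) (ℕP.m≤n⇒∣n-m∣≡n∸m y≤x) ⟨
  frac ∣ x - y ∣ D                            ∎
  where
  open ≡-Reasoning
  d = x ∸ y
  x-split : frac x D ≡ frac y D ℚ.+ frac d D
  x-split = trans (cong (λ z → frac z D) (sym (ℕP.m+[n∸m]≡n y≤x))) (sym (frac-+ y d D))
  [p+q]-p≡q : ∀ p q → (p ℚ.+ q) ℚ.- p ≡ q
  [p+q]-p≡q p q = begin
    (p ℚ.+ q) ℚ.- p      ≡⟨ cong (ℚ._- p) (ℚP.+-comm p q) ⟩
    (q ℚ.+ p) ℚ.- p      ≡⟨ ℚP.+-assoc q p (ℚ.- p) ⟩
    q ℚ.+ (p ℚ.- p)      ≡⟨ cong (q ℚ.+_) (ℚP.+-inverseʳ p) ⟩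
    q ℚ.+ 0ℚ             ≡⟨ ℚP.+-identityʳ q ⟩
    q                    ∎

∣frac-frac∣-cross : ∀ a b c d →
  ℚ.∣ frac a (suc b) ℚ.- frac c (suc d) ∣ ≡ frac ∣ a * suc d - c * suc b ∣ (suc b * suc d)
∣frac-frac∣-cross a b c d = begin
  ℚ.∣ frac a (suc b) ℚ.- frac c (suc d) ∣            ≡⟨ cong₂ (λ u v → ℚ.∣ u ℚ.- v ∣) expand-a expand-c ⟩
  ℚ.∣ frac (a * suc d) BD ℚ.- frac (c * suc b) BD ∣  ≡⟨ ∣frac-frac∣ (a * suc d) (c * suc b) BD ⟩
  frac ∣ a * suc d - c * suc b ∣ BD                  ∎
  where
  open ≡-Reasoning
  BD = suc b * suc d
  expand-a : frac a (suc b) ≡ frac (a * suc d) BD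
  expand-a = frac-≡ a b (a * suc d) (d + b * suc d)
    (solve 3 (λ a b d → a :* ((con 1 :+ b) :* (con 1 :+ d)) := (a :* (con 1 :+ d)) :* (con 1 :+ b)) refl a b d)
  expand-c : frac c (suc d) ≡ frac (c * suc b) BD
  expand-c = frac-≡ c d (c * suc b) (d + b * suc d)
    (solve 3 (λ c b d → c :* ((con 1 :+ b) :* (con 1 :+ d)) := (c :* (con 1 :+ b)) :* (con 1 :+ d)) refl c b d)

*-monoˡ-≤-nonneg : ∀ {c a b} → 0ℚ ℚ.≤ c → a ℚ.≤ b → c ℚ.* a ℚ.≤ c ℚ.* b
*-monoˡ-≤-nonneg {c} 0≤c a≤b = let instance _ = ℚ.nonNegative 0≤c in ℚP.*-monoˡ-≤-nonNeg c a≤b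

*-monoʳ-≤-nonneg : ∀ {c a b} → 0ℚ ℚ.≤ c → a ℚ.≤ b → a ℚ.* c ℚ.≤ b ℚ.* c
*-monoʳ-≤-nonneg {c} 0≤c a≤b = let instance _ = ℚ.nonNegative 0≤c in ℚP.*-monoʳ-≤-nonNeg c a≤b

*-nonneg : ∀ {a b} → 0ℚ ℚ.≤ a → 0ℚ ℚ.≤ b → 0ℚ ℚ.≤ a ℚ.* b
*-nonneg {a} 0≤a 0≤b = ℚP.≤-trans (ℚP.≤-reflexive (sym (ℚP.*-zeroʳ a))) (*-monoˡ-≤-nonneg 0≤a 0≤b)

^-nonneg : ∀ {x} e → 0ℚ ℚ.≤ x → 0ℚ ℚ.≤ x ^ℚ e
^-nonneg zero    _   = frac-nonneg 1 1
^-nonneg (suc e) 0≤x = *-nonneg 0≤x (^-nonneg e 0≤x)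

^-mono-≤ : ∀ {x y} e → 0ℚ ℚ.≤ x → x ℚ.≤ y → x ^ℚ e ℚ.≤ y ^ℚ e
^-mono-≤ zero    _   _   = ℚP.≤-refl
^-mono-≤ (suc e) 0≤x x≤y = ℚP.≤-trans (*-monoˡ-≤-nonneg 0≤x (^-mono-≤ e 0≤x x≤y))
                                      (*-monoʳ-≤-nonneg (^-nonneg e (ℚP.≤-trans 0≤x x≤y)) x≤y)

∣*-*∣ : ∀ c u v → 0ℚ ℚ.≤ c → ℚ.∣ c ℚ.* u ℚ.- c ℚ.* v ∣ ≡ c ℚ.* ℚ.∣ u ℚ.- v ∣
∣*-*∣ c u v 0≤c = begin
  ℚ.∣ c ℚ.* u ℚ.- c ℚ.* v ∣        ≡⟨ cong (λ z → ℚ.∣ c ℚ.* u ℚ.+ z ∣) (ℚP.neg-distribʳ-* c v) ⟩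
  ℚ.∣ c ℚ.* u ℚ.+ c ℚ.* ℚ.- v ∣    ≡⟨ cong ℚ.∣_∣ (ℚP.*-distribˡ-+ c u (ℚ.- v)) ⟨
  ℚ.∣ c ℚ.* (u ℚ.- v) ∣            ≡⟨ ℚP.∣p*q∣≡∣p∣*∣q∣ c (u ℚ.- v) ⟩
  ℚ.∣ c ∣ ℚ.* ℚ.∣ u ℚ.- v ∣        ≡⟨ cong (ℚ._* ℚ.∣ u ℚ.- v ∣) (ℚP.0≤p⇒∣p∣≡p 0≤c) ⟩
  c ℚ.* ℚ.∣ u ℚ.- v ∣              ∎
  where open ≡-Reasoning

module _ {A : Set} where

  sumℚ-cong : (L : List A) {f g : A → ℚ} → (∀ x → f x ≡ g x) → sumℚ L f ≡ sumℚ L g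
  sumℚ-cong []      f≡g = refl
  sumℚ-cong (x ∷ L) f≡g = cong₂ ℚ._+_ (f≡g x) (sumℚ-cong L f≡g)

  sumℚ-mono : (L : List A) {f g : A → ℚ} → (∀ x → f x ℚ.≤ g x) → sumℚ L f ℚ.≤ sumℚ L g
  sumℚ-mono []      f≤g = ℚP.≤-refl
  sumℚ-mono (x ∷ L) f≤g = ℚP.+-mono-≤ (f≤g x) (sumℚ-mono L f≤g)

  sumℚ-nonneg : (L : List A) {f : A → ℚ} → (∀ x → 0ℚ ℚ.≤ f x) → 0ℚ ℚ.≤ sumℚ L f
  sumℚ-nonneg []      0≤f = ℚP.≤-refl
  sumℚ-nonneg (x ∷ L) 0≤f = ℚP.+-mono-≤ (0≤f x) (sumℚ-nonneg L 0≤f)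

  sumℚ-*ˡ : (L : List A) (c : ℚ) (f : A → ℚ) → sumℚ L (λ x → c ℚ.* f x) ≡ c ℚ.* sumℚ L f
  sumℚ-*ˡ []      c f = sym (ℚP.*-zeroʳ c)
  sumℚ-*ˡ (x ∷ L) c f = trans (cong (c ℚ.* f x ℚ.+_) (sumℚ-*ˡ L c f))
                              (sym (ℚP.*-distribˡ-+ c (f x) (sumℚ L f)))

sumℕ : {A : Set} → List A → (A → ℕ) → ℕ
sumℕ []      f = 0
sumℕ (x ∷ L) f = f x + sumℕ L f

module _ {A : Set} where

  sumℚ-frac : (L : List A) (f : A → ℕ) (D : ℕ) → sumℚ L (λ x → frac (f x) D) ≡ frac (sumℕ L f) D
  sumℚ-frac []      f D = sym (frac-zero D)
  sumℚ-frac (x ∷ L) f D = trans (cong (frac (f x) D ℚ.+_) (sumℚ-frac L f D)) (frac-+ (f x) (sumℕ L f) D)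

  sumℕ-cong : (L : List A) {f g : A → ℕ} → (∀ x → f x ≡ g x) → sumℕ L f ≡ sumℕ L g
  sumℕ-cong []      f≡g = refl
  sumℕ-cong (x ∷ L) f≡g = cong₂ _+_ (f≡g x) (sumℕ-cong L f≡g)

  sumℕ-mono : (L : List A) {f g : A → ℕ} → (∀ x → f x ≤ g x) → sumℕ L f ≤ sumℕ L g
  sumℕ-mono []      f≤g = ℕ.z≤n
  sumℕ-mono (x ∷ L) f≤g = ℕP.+-mono-≤ (f≤g x) (sumℕ-mono L f≤g)

  sumℕ-zero : (L : List A) → sumℕ L (λ _ → 0) ≡ 0
  sumℕ-zero []      = refl
  sumℕ-zero (x ∷ L) = sumℕ-zero L

  sumℕ-const : (L : List A) (c : ℕ) → sumℕ L (λ _ → c) ≡ c * length L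
  sumℕ-const []      c = sym (ℕP.*-zeroʳ c)
  sumℕ-const (x ∷ L) c = trans (cong (_+_ c) (sumℕ-const L c)) (sym (ℕP.*-suc c (length L)))

  sumℕ-+ : (L : List A) (f g : A → ℕ) → sumℕ L (λ x → f x + g x) ≡ sumℕ L f + sumℕ L g
  sumℕ-+ []      f g = refl
  sumℕ-+ (x ∷ L) f g = trans (cong (_+_ (f x + g x)) (sumℕ-+ L f g))
    (solve 4 (λ a b c d → (a :+ b) :+ (c :+ d) := (a :+ c) :+ (b :+ d)) refl (f x) (g x) (sumℕ L f) (sumℕ L g))

  sumℕ-*ˡ : (L : List A) (c : ℕ) (f : A → ℕ) → sumℕ L (λ x → c * f x) ≡ c * sumℕ L f
  sumℕ-*ˡ []      c f = sym (ℕP.*-zeroʳ c)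
  sumℕ-*ˡ (x ∷ L) c f = trans (cong (_+_ (c * f x)) (sumℕ-*ˡ L c f)) (sym (ℕP.*-distribˡ-+ c (f x) _))

  sumℕ-*ʳ : (L : List A) (f : A → ℕ) (c : ℕ) → sumℕ L (λ x → f x * c) ≡ sumℕ L f * c
  sumℕ-*ʳ L f c = begin
    sumℕ L (λ x → f x * c)  ≡⟨ sumℕ-cong L (λ x → ℕP.*-comm (f x) c) ⟩
    sumℕ L (λ x → c * f x)  ≡⟨ sumℕ-*ˡ L c f ⟩
    c * sumℕ L f            ≡⟨ ℕP.*-comm c (sumℕ L f) ⟩
    sumℕ L f * c            ∎
    where open ≡-Reasoning

  sumℕ-++ : (L K : List A) (f : A → ℕ) → sumℕ (L ++ K) f ≡ sumℕ L f + sumℕ K f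
  sumℕ-++ []      K f = refl
  sumℕ-++ (x ∷ L) K f = trans (cong (_+_ (f x)) (sumℕ-++ L K f)) (sym (ℕP.+-assoc (f x) _ _))

  sumℕ-map : {B : Set} (h : B → A) (L : List B) (f : A → ℕ) → sumℕ (map h L) f ≡ sumℕ L (f ∘ h)
  sumℕ-map h []      f = refl
  sumℕ-map h (x ∷ L) f = cong (_+_ (f (h x))) (sumℕ-map h L f)

  sumℕ-concatMap : {B : Set} (h : B → List A) (L : List B) (f : A → ℕ) →
                   sumℕ (concatMap h L) f ≡ sumℕ L (λ b → sumℕ (h b) f)
  sumℕ-concatMap h []      f = refl
  sumℕ-concatMap h (x ∷ L) f =
    trans (sumℕ-++ (h x) (concatMap h L) f) (cong (_+_ (sumℕ (h x) f)) (sumℕ-concatMap h L f))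

  sumℕ-filter-≤ : {P : A → Set} (P? : Decidable P) (L : List A) (f : A → ℕ) →
                  sumℕ (filter P? L) f ≤ sumℕ L f
  sumℕ-filter-≤ P? []      f = ℕ.z≤n
  sumℕ-filter-≤ P? (x ∷ L) f with P? x
  ... | yes _ = ℕP.+-monoʳ-≤ (f x) (sumℕ-filter-≤ P? L f)
  ... | no  _ = ℕP.≤-trans (sumℕ-filter-≤ P? L f) (ℕP.m≤n+m _ (f x))

sumℕ-swap : {A B : Set} (L : List A) (K : List B) (f : A → B → ℕ) →
  sumℕ L (λ a → sumℕ K (f a)) ≡ sumℕ K (λ b → sumℕ L (λ a → f a b))
sumℕ-swap []      K f = sym (sumℕ-zero K)
sumℕ-swap (x ∷ L) K f = trans (cong (_+_ (sumℕ K (f x))) (sumℕ-swap L K f))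
                              (sym (sumℕ-+ K (f x) (λ b → sumℕ L (λ a → f a b))))

𝟙 : {P : Set} → Dec P → ℕ
𝟙 (yes _) = 1
𝟙 (no  _) = 0

𝟙-cong : {P Q : Set} → (P → Q) → (Q → P) → (p : Dec P) (q : Dec Q) → 𝟙 p ≡ 𝟙 q
𝟙-cong P→Q Q→P (yes p) (yes q) = refl
𝟙-cong P→Q Q→P (yes p) (no ¬q) = ⊥-elim (¬q (P→Q p))
𝟙-cong P→Q Q→P (no ¬p) (yes q) = ⊥-elim (¬p (Q→P q))
𝟙-cong P→Q Q→P (no ¬p) (no ¬q) = refl

length-filter-𝟙 : {A : Set} {P : A → Set} (P? : Decidable P) (L : List A) →
                  length (filter P? L) ≡ sumℕ L (λ x → 𝟙 (P? x))
length-filter-𝟙 P? []      = refl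
length-filter-𝟙 P? (x ∷ L) with P? x
... | yes _ = cong suc (length-filter-𝟙 P? L)
... | no  _ = length-filter-𝟙 P? L

sumℕ-1 : {A : Set} (L : List A) → sumℕ L (λ _ → 1) ≡ length L
sumℕ-1 L = trans (sumℕ-const L 1) (ℕP.*-identityˡ (length L))

sumFin-suc : ∀ n (g : Fin (suc n) → ℕ) →
             sumℕ (allFin (suc n)) g ≡ g Fin.zero + sumℕ (allFin n) (g ∘ Fin.suc)
sumFin-suc n g = cong (_+_ (g Fin.zero))
  (trans (cong (λ L → sumℕ L g) (sym (ListP.map-tabulate (λ i → i) Fin.suc)))
         (sumℕ-map Fin.suc (allFin n) g))

sumFin-const : ∀ n c → sumℕ (allFin n) (λ _ → c) ≡ n * c
sumFin-const n c = begin
  sumℕ (allFin n) (λ _ → c)  ≡⟨ sumℕ-const (allFin n) c ⟩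
  c * length (allFin n)      ≡⟨ cong (c *_) (ListP.length-tabulate (λ i → i)) ⟩
  c * n                      ≡⟨ ℕP.*-comm c n ⟩
  n * c                      ∎
  where open ≡-Reasoning

≤-sumFin : ∀ n (g : Fin n → ℕ) (x : Fin n) → g x ≤ sumℕ (allFin n) g
≤-sumFin (suc n) g x = ℕP.≤-trans (bound x) (ℕP.≤-reflexive (sym (sumFin-suc n g)))
  where
  bound : ∀ x → g x ≤ g Fin.zero + sumℕ (allFin n) (g ∘ Fin.suc)
  bound Fin.zero    = ℕP.m≤m+n (g Fin.zero) _
  bound (Fin.suc x) = ℕP.≤-trans (≤-sumFin n (g ∘ Fin.suc) x) (ℕP.m≤n+m _ (g Fin.zero))

sumFin-select : ∀ n (y : Fin n) (g : Fin n → ℕ) → sumℕ (allFin n) (λ x → 𝟙 (y ≟ x) * g x) ≡ g y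
sumFin-select (suc n) Fin.zero g = begin
  sumℕ (allFin (suc n)) (λ x → 𝟙 (Fin.zero ≟ x) * g x)     ≡⟨ sumFin-suc n (λ x → 𝟙 (Fin.zero ≟ x) * g x) ⟩
  1 * g Fin.zero + sumℕ (allFin n) (λ _ → 0)                ≡⟨ cong₂ _+_ (ℕP.*-identityˡ _) (sumℕ-zero (allFin n)) ⟩
  g Fin.zero + 0                                           ≡⟨ ℕP.+-identityʳ _ ⟩
  g Fin.zero                                               ∎
  where open ≡-Reasoning
sumFin-select (suc n) (Fin.suc y) g = begin
  sumℕ (allFin (suc n)) (λ x → 𝟙 (Fin.suc y ≟ x) * g x)                ≡⟨ sumFin-suc n (λ x → 𝟙 (Fin.suc y ≟ x) * g x) ⟩
  sumℕ (allFin n) (λ x → 𝟙 (Fin.suc y ≟ Fin.suc x) * g (Fin.suc x))    ≡⟨ sumℕ-cong (allFin n) drop-suc ⟩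
  sumℕ (allFin n) (λ x → 𝟙 (y ≟ x) * g (Fin.suc x))                    ≡⟨ sumFin-select n y (g ∘ Fin.suc) ⟩
  g (Fin.suc y)                                                        ∎
  where
  open ≡-Reasoning
  drop-suc : ∀ x → 𝟙 (Fin.suc y ≟ Fin.suc x) * g (Fin.suc x) ≡ 𝟙 (y ≟ x) * g (Fin.suc x)
  drop-suc x with y ≟ x
  ... | yes _ = refl
  ... | no  _ = refl

sumFin-point : ∀ n (y : Fin n) → sumℕ (allFin n) (λ x → 𝟙 (y ≟ x)) ≡ 1
sumFin-point n y = trans (sumℕ-cong (allFin n) (λ x → sym (ℕP.*-identityʳ _))) (sumFin-select n y (λ _ → 1))

sumTuples-suc : ∀ N n (g : Vec (Fin n) (suc N) → ℕ) →
  sumℕ (allTuples (suc N) n) g ≡ sumℕ (allFin n) (λ a → sumℕ (allTuples N n) (λ as → g (a ∷ as)))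
sumTuples-suc N n g = trans (sumℕ-concatMap _ (allFin n) g)
                            (sumℕ-cong (allFin n) (λ a → sumℕ-map (a ∷_) (allTuples N n) g))

count-tuples : ∀ N n → length (allTuples N n) ≡ n ^ N
count-tuples zero    n = refl
count-tuples (suc N) n = begin
  length (allTuples (suc N) n)                                   ≡⟨ sumℕ-1 (allTuples (suc N) n) ⟨
  sumℕ (allTuples (suc N) n) (λ _ → 1)                           ≡⟨ sumTuples-suc N n (λ _ → 1) ⟩
  sumℕ (allFin n) (λ _ → sumℕ (allTuples N n) (λ _ → 1))         ≡⟨ sumℕ-cong (allFin n) (λ _ → trans (sumℕ-1 (allTuples N n)) (count-tuples N n)) ⟩
  sumℕ (allFin n) (λ _ → n ^ N)                                  ≡⟨ sumFin-const n (n ^ N) ⟩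
  n ^ suc N                                                      ∎
  where open ≡-Reasoning

sumSubsets-suc : ∀ N (g : Subset (suc N) → ℕ) →
  sumℕ (allSubsets (suc N)) g ≡ sumℕ (allSubsets N) (g ∘ (true ∷_)) + sumℕ (allSubsets N) (g ∘ (false ∷_))
sumSubsets-suc N g = trans (sumℕ-++ (map (true ∷_) L) (map (false ∷_) L) g)
                           (cong₂ _+_ (sumℕ-map (true ∷_) L g) (sumℕ-map (false ∷_) L g))
  where L = allSubsets N

sameSubset : ∀ {N} → Subset N → Subset N → ℕ
sameSubset []          []          = 1
sameSubset (true ∷ I)  (true ∷ J)  = sameSubset I J
sameSubset (true ∷ I)  (false ∷ J) = 0
sameSubset (false ∷ I) (true ∷ J)  = 0
sameSubset (false ∷ I) (false ∷ J) = sameSubset I J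

sameSubset-count : ∀ N (I : Subset N) → sumℕ (allSubsets N) (λ J → sameSubset J I) ≡ 1
sameSubset-count zero    []          = refl
sameSubset-count (suc N) (true ∷ I)  = begin
  sumℕ (allSubsets (suc N)) (λ J → sameSubset J (true ∷ I))          ≡⟨ sumSubsets-suc N _ ⟩
  sumℕ (allSubsets N) (λ J → sameSubset J I) + sumℕ (allSubsets N) (λ _ → 0)
                                                                    ≡⟨ cong₂ _+_ (sameSubset-count N I) (sumℕ-zero (allSubsets N)) ⟩
  1                                                                 ∎
  where open ≡-Reasoning
sameSubset-count (suc N) (false ∷ I) = begin
  sumℕ (allSubsets (suc N)) (λ J → sameSubset J (false ∷ I))         ≡⟨ sumSubsets-suc N _ ⟩
  sumℕ (allSubsets N) (λ _ → 0) + sumℕ (allSubsets N) (λ J → sameSubset J I)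
                                                                    ≡⟨ cong₂ _+_ (sumℕ-zero (allSubsets N)) (sameSubset-count N I) ⟩
  1                                                                 ∎
  where open ≡-Reasoning

#subsets : ℕ → ℕ → ℕ
#subsets N r = sumℕ (allSubsets N) (λ I → 𝟙 (∣ I ∣ ℕ.≟ r))

-- C(N, r) ≤ N^r, via Pascal's rule C(N+1, r+1) = C(N, r) + C(N, r+1).
#subsets-≤ : ∀ N r → #subsets N r ≤ N ^ r
#subsets-≤ zero    zero    = ℕP.≤-refl
#subsets-≤ zero    (suc r) = ℕ.z≤n
#subsets-≤ (suc N) r = begin
  #subsets (suc N) r                                               ≡⟨ sumSubsets-suc N _ ⟩
  sumℕ (allSubsets N) (λ I → 𝟙 (suc ∣ I ∣ ℕ.≟ r)) + #subsets N r  ≤⟨ pascal r ⟩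
  suc N ^ r                                                        ∎
  where
  open ℕP.≤-Reasoning
  pascal : ∀ r → sumℕ (allSubsets N) (λ I → 𝟙 (suc ∣ I ∣ ℕ.≟ r)) + #subsets N r ≤ suc N ^ r
  pascal zero    = ℕP.≤-trans (ℕP.≤-reflexive (cong (_+ #subsets N 0) (sumℕ-zero (allSubsets N))))
                              (#subsets-≤ N zero)
  pascal (suc r) = begin
    sumℕ (allSubsets N) (λ I → 𝟙 (suc ∣ I ∣ ℕ.≟ suc r)) + #subsets N (suc r)
      ≡⟨ cong (_+ #subsets N (suc r)) (sumℕ-cong (allSubsets N) (λ I →
           𝟙-cong ℕP.suc-injective (cong suc) (suc ∣ I ∣ ℕ.≟ suc r) (∣ I ∣ ℕ.≟ r))) ⟩
    #subsets N r + #subsets N (suc r)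
      ≤⟨ ℕP.+-mono-≤ (#subsets-≤ N r) (#subsets-≤ N (suc r)) ⟩
    N ^ r + N * N ^ r
      ≤⟨ ℕP.+-mono-≤ (ℕP.^-monoˡ-≤ r (ℕP.n≤1+n N)) (ℕP.*-monoʳ-≤ N (ℕP.^-monoˡ-≤ r (ℕP.n≤1+n N))) ⟩
    suc N ^ suc r ∎

-- The profile inequality
--
-- For a "multiplicity profile" f : X → ℕ on a finite list L of points, with
-- total mass T = Σ f, support size S = #{x : f x > 0} and collision number
-- D = Σ f x (f x − 1), the conditional distributions f/T and 𝟙₊ f/S differ by
--   Σ_x | f x / T − 𝟙₊ (f x) / S | ≤ 2D / T,
-- which is stated here with denominators cleared.

𝟙₊ : ℕ → ℕ
𝟙₊ zero    = 0
𝟙₊ (suc _) = 1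

-- At a single point the difference of the two conditional probabilities is one
-- fraction; S > 0 whenever k > 0 because S counts the support.
∣frac-frac𝟙₊∣ : ∀ k T S → k ≤ T → (0 < k → 0 < S) →
  ℚ.∣ frac k T ℚ.- frac (𝟙₊ k) S ∣ ≡ frac ∣ k * S - 𝟙₊ k * T ∣ (T * S)
∣frac-frac𝟙₊∣ zero    T S _ _ =
  trans (cong₂ (λ u v → ℚ.∣ u ℚ.- v ∣) (frac-zero T) (frac-zero S)) (sym (frac-zero (T * S)))
∣frac-frac𝟙₊∣ (suc k) (suc T) S _ S>0 with S>0 (ℕ.s≤s ℕ.z≤n)
... | ℕ.s≤s {n = S′} _ = ∣frac-frac∣-cross (suc k) T 1 S′

frac-cancel-≤ : ∀ a c T S → a ≤ S * c → frac a (T * S) ℚ.≤ frac c T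
frac-cancel-≤ a c zero    S _      = ℚP.≤-refl
frac-cancel-≤ a c (suc t) S a≤S*c = frac-≤ a (suc t * S) c (suc t) (begin
  a * suc t          ≤⟨ ℕP.*-monoˡ-≤ (suc t) a≤S*c ⟩
  S * c * suc t      ≡⟨ solve 3 (λ s c t → s :* c :* t := c :* (t :* s)) refl S c (suc t) ⟩
  c * (suc t * S)    ∎)
  where open ℕP.≤-Reasoning

-- The summand at a point of multiplicity k, with the total mass written as
-- S + R (R = surplus over the support size S): |kS − (S + R)| ≤ (k − 1)S + R
-- if k > 0, and it vanishes if k = 0.
∣k*S-𝟙₊k*[S+R]∣≤ : ∀ k S R → ∣ k * S - 𝟙₊ k * (S + R) ∣ ≤ (k ∸ 1) * S + 𝟙₊ k * R
∣k*S-𝟙₊k*[S+R]∣≤ zero    S R = ℕ.z≤n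
∣k*S-𝟙₊k*[S+R]∣≤ (suc k) S R = begin
  ∣ S + k * S - (S + R) + 0 ∣  ≡⟨ cong (λ z → ∣ S + k * S - z ∣) (ℕP.+-identityʳ (S + R)) ⟩
  ∣ S + k * S - S + R ∣        ≡⟨ ℕP.∣m+n-m+o∣≡∣n-o∣ S (k * S) R ⟩
  ∣ k * S - R ∣                ≤⟨ ℕP.∣m-n∣≤m⊔n (k * S) R ⟩
  k * S ℕ.⊔ R                  ≤⟨ ℕP.m⊔n≤m+n (k * S) R ⟩
  k * S + R                    ≡⟨ cong (_+_ (k * S)) (ℕP.+-identityʳ R) ⟨
  k * S + (R + 0)              ∎
  where open ℕP.≤-Reasoning

module Profile {X : Set} (L : List X) (f : X → ℕ) where

  total support surplus collisions : ℕ
  total      = sumℕ L f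
  support    = sumℕ L (λ x → 𝟙₊ (f x))
  surplus    = sumℕ L (λ x → f x ∸ 1)
  collisions = sumℕ L (λ x → f x * (f x ∸ 1))

  -- Each point of the support contributes 1 to S and f x − 1 to the surplus.
  total≡support+surplus : total ≡ support + surplus
  total≡support+surplus = trans (sumℕ-cong L (λ x → split (f x))) (sumℕ-+ L (λ x → 𝟙₊ (f x)) (λ x → f x ∸ 1))
    where
    split : ∀ k → k ≡ 𝟙₊ k + (k ∸ 1)
    split zero    = refl
    split (suc k) = refl

  -- Each surplus copy at x collides with at least one other copy.
  surplus≤collisions : surplus ≤ collisions
  surplus≤collisions = sumℕ-mono L (λ x → k∸1≤k*[k∸1] (f x))
    where
    k∸1≤k*[k∸1] : ∀ k → k ∸ 1 ≤ k * (k ∸ 1)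
    k∸1≤k*[k∸1] zero    = ℕ.z≤n
    k∸1≤k*[k∸1] (suc k) = ℕP.m≤m+n k (k * k)

  -- Σ f² = D + T: ordered pairs of copies at a common point are the diagonal
  -- pairs plus the collisions.
  sum-of-squares : sumℕ L (λ x → f x * f x) ≡ collisions + total
  sum-of-squares = trans (sumℕ-cong L (λ x → square (f x))) (sumℕ-+ L (λ x → f x * (f x ∸ 1)) f)
    where
    square : ∀ k → k * k ≡ k * (k ∸ 1) + k
    square zero    = refl
    square (suc k) = solve 1 (λ k → (con 1 :+ k) :* (con 1 :+ k) := (con 1 :+ k) :* k :+ (con 1 :+ k)) refl k

  -- Σ_x |f x · S − 𝟙₊(f x) · T| ≤ S · 2D, i.e. the profile inequality times T·S.
  profile-inequality : sumℕ L (λ x → ∣ f x * support - 𝟙₊ (f x) * total ∣) ≤ support * (2 * collisions)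
  profile-inequality = begin
    sumℕ L (λ x → ∣ f x * S - 𝟙₊ (f x) * total ∣)
      ≡⟨ sumℕ-cong L (λ x → cong (λ t → ∣ f x * S - 𝟙₊ (f x) * t ∣) total≡support+surplus) ⟩
    sumℕ L (λ x → ∣ f x * S - 𝟙₊ (f x) * (S + R) ∣)
      ≤⟨ sumℕ-mono L (λ x → ∣k*S-𝟙₊k*[S+R]∣≤ (f x) S R) ⟩
    sumℕ L (λ x → (f x ∸ 1) * S + 𝟙₊ (f x) * R)
      ≡⟨ sumℕ-+ L (λ x → (f x ∸ 1) * S) (λ x → 𝟙₊ (f x) * R) ⟩
    sumℕ L (λ x → (f x ∸ 1) * S) + sumℕ L (λ x → 𝟙₊ (f x) * R)
      ≡⟨ cong₂ _+_ (sumℕ-*ʳ L (λ x → f x ∸ 1) S) (sumℕ-*ʳ L (λ x → 𝟙₊ (f x)) R) ⟩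
    R * S + S * R
      ≤⟨ ℕP.+-mono-≤ (ℕP.*-monoˡ-≤ S surplus≤collisions) (ℕP.*-monoʳ-≤ S surplus≤collisions) ⟩
    collisions * S + S * collisions
      ≡⟨ solve 2 (λ s d → d :* s :+ s :* d := s :* (con 2 :* d)) refl S collisions ⟩
    S * (2 * collisions) ∎
    where
    open ℕP.≤-Reasoning
    S = support
    R = surplus

-- Collisions of subset sums in a finite group
--
-- For subsets I, J ⊆ [N], let C(I, J) be the number of tuples A ∈ G^N with
-- Σ_{i∈I} a_i = Σ_{j∈J} a_j. If I ≠ J, some coordinate a_i occurs on one side
-- only and is then uniquely determined by the others, so C(I, J) = n^(N−1);
-- if I = J, then C(I, J) = n^N.

module Collisions {n : ℕ} (_∙_ : Op₂ (Fin n)) (ε : Fin n) (inv : Op₁ (Fin n))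
                  (isGroup : IsGroup _≡_ _∙_ ε inv) where

  -- The group as a library bundle, to reuse its cancellation and division laws.
  G : Group 0ℓ 0ℓ
  G = record { Carrier = Fin n; _≈_ = _≡_; _∙_ = _∙_; ε = ε; _⁻¹ = inv; isGroup = isGroup }

  open GroupProperties G using (quasigroup; //-rightDividesˡ)
  open QuasigroupProperties quasigroup using (cancelˡ; x≈z//y)

  σ : ∀ {N} → Vec (Fin n) N → Subset N → Fin n
  σ = subsetSum _∙_ ε

  collisionsOf : ∀ {N} → Subset N → Subset N → ℕ
  collisionsOf {N} I J = sumℕ (allTuples N n) (λ A → 𝟙 (σ A I ≟ σ A J))

  translation-unique : ∀ u v → sumℕ (allFin n) (λ a → 𝟙 (a ∙ u ≟ v)) ≡ 1
  translation-unique u v =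
    trans (sumℕ-cong (allFin n) (λ a → 𝟙-cong (λ au≡v → sym (x≈z//y a u v au≡v))
                                              (λ v/u≡a → trans (cong (_∙ u) (sym v/u≡a)) (//-rightDividesˡ u v))
                                              (a ∙ u ≟ v) ((v ∙ inv u) ≟ a)))
          (sumFin-point n (v ∙ inv u))

  -- C is symmetric, so the case of a coordinate in J only reduces to I only.
  collisions-sym : ∀ {N} (I J : Subset N) → collisionsOf I J ≡ collisionsOf J I
  collisions-sym {N} I J = sumℕ-cong (allTuples N n) (λ A → 𝟙-cong sym sym (σ A I ≟ σ A J) (σ A J ≟ σ A I))

  collisions-empty : collisionsOf [] [] ≡ 1
  collisions-empty with ε ≟ ε
  ... | yes _   = refl
  ... | no ε≢ε = ⊥-elim (ε≢ε refl)

  -- A coordinate lying in both or in neither subset is free.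
  collisions-same-head : ∀ {N} b (I J : Subset N) → collisionsOf (b ∷ I) (b ∷ J) ≡ n * collisionsOf I J
  collisions-same-head {N} true I J = begin
    collisionsOf (true ∷ I) (true ∷ J)
      ≡⟨ sumTuples-suc N n (λ A → 𝟙 (σ A (true ∷ I) ≟ σ A (true ∷ J))) ⟩
    sumℕ (allFin n) (λ a → sumℕ (allTuples N n) (λ A → 𝟙 ((a ∙ σ A I) ≟ (a ∙ σ A J))))
      ≡⟨ sumℕ-cong (allFin n) (λ a → sumℕ-cong (allTuples N n) (λ A →
           𝟙-cong (cancelˡ a _ _) (cong (a ∙_)) ((a ∙ σ A I) ≟ (a ∙ σ A J)) (σ A I ≟ σ A J))) ⟩
    sumℕ (allFin n) (λ _ → collisionsOf I J)
      ≡⟨ sumFin-const n (collisionsOf I J) ⟩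
    n * collisionsOf I J ∎
    where open ≡-Reasoning
  collisions-same-head {N} false I J =
    trans (sumTuples-suc N n (λ A → 𝟙 (σ A (false ∷ I) ≟ σ A (false ∷ J))))
          (sumFin-const n (collisionsOf I J))

  -- A coordinate lying in I only is determined by the others.
  collisions-split-head : ∀ {N} (I J : Subset N) → collisionsOf (true ∷ I) (false ∷ J) ≡ n ^ N
  collisions-split-head {N} I J = begin
    collisionsOf (true ∷ I) (false ∷ J)
      ≡⟨ sumTuples-suc N n (λ A → 𝟙 (σ A (true ∷ I) ≟ σ A (false ∷ J))) ⟩
    sumℕ (allFin n) (λ a → sumℕ (allTuples N n) (λ A → 𝟙 ((a ∙ σ A I) ≟ σ A J)))
      ≡⟨ sumℕ-swap (allFin n) (allTuples N n) (λ a A → 𝟙 ((a ∙ σ A I) ≟ σ A J)) ⟩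
    sumℕ (allTuples N n) (λ A → sumℕ (allFin n) (λ a → 𝟙 ((a ∙ σ A I) ≟ σ A J)))
      ≡⟨ sumℕ-cong (allTuples N n) (λ A → translation-unique (σ A I) (σ A J)) ⟩
    sumℕ (allTuples N n) (λ _ → 1)
      ≡⟨ trans (sumℕ-1 (allTuples N n)) (count-tuples N n) ⟩
    n ^ N ∎
    where open ≡-Reasoning

  same-head-step : ∀ {N} b (I J : Subset N) →
    n * collisionsOf I J ≤ n ^ N + sameSubset I J * (n * n ^ N) →
    n * collisionsOf (b ∷ I) (b ∷ J) ≤ n ^ suc N + sameSubset I J * (n * n ^ suc N)
  same-head-step {N} b I J bound = begin
    n * collisionsOf (b ∷ I) (b ∷ J)        ≡⟨ cong (n *_) (collisions-same-head b I J) ⟩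
    n * (n * collisionsOf I J)              ≤⟨ ℕP.*-monoʳ-≤ n bound ⟩
    n * (n ^ N + e * (n * n ^ N))           ≡⟨ solve 3 (λ n p e → n :* (p :+ e :* (n :* p)) := n :* p :+ e :* (n :* (n :* p)))
                                                     refl n (n ^ N) e ⟩
    n ^ suc N + e * (n * n ^ suc N)         ∎
    where
    open ℕP.≤-Reasoning
    e = sameSubset I J

  split-head-step : ∀ {N C} → C ≡ n ^ N → n * C ≤ n ^ suc N + 0
  split-head-step {N} C≡n^N = ℕP.≤-reflexive (trans (cong (n *_) C≡n^N) (sym (ℕP.+-identityʳ (n ^ suc N))))

  -- n · C(I, J) ≤ n^N + [I = J] · n^(N+1), i.e. C(I, J) = n^(N−1) for I ≠ J.
  collision-bound : ∀ N (I J : Subset N) → n * collisionsOf I J ≤ n ^ N + sameSubset I J * (n * n ^ N)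
  collision-bound zero    []          []          = begin
    n * collisionsOf [] []  ≡⟨ cong (n *_) collisions-empty ⟩
    n * 1                   ≤⟨ ℕP.m≤n+m (n * 1) 1 ⟩
    1 + n * 1               ≡⟨ cong (_+_ 1) (ℕP.*-identityˡ (n * 1)) ⟨
    1 + 1 * (n * 1)         ∎
    where open ℕP.≤-Reasoning
  collision-bound (suc N) (true ∷ I)  (true ∷ J)  = same-head-step true I J (collision-bound N I J)
  collision-bound (suc N) (false ∷ I) (false ∷ J) = same-head-step false I J (collision-bound N I J)
  collision-bound (suc N) (true ∷ I)  (false ∷ J) = split-head-step {N} (collisions-split-head I J)
  collision-bound (suc N) (false ∷ I) (true ∷ J)  =
    split-head-step {N} (trans (collisions-sym (false ∷ I) (true ∷ J)) (collisions-split-head J I))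

-- The statistical distance

#subsetsOfSize-≤ : ∀ N r → length (subsetsOfSize N r) ≤ N ^ r
#subsetsOfSize-≤ N r =
  ℕP.≤-trans (ℕP.≤-reflexive (length-filter-𝟙 (λ I → ∣ I ∣ ℕ.≟ r) (allSubsets N))) (#subsets-≤ N r)

statDist-nonneg : ∀ n N (_∙_ : Op₂ (Fin n)) ε r → 0ℚ ℚ.≤ statDist n N _∙_ ε r
statDist-nonneg n N _∙_ ε r = *-nonneg (frac-nonneg 1 2)
  (sumℚ-nonneg (allTuples N n) (λ A → sumℚ-nonneg (allFin n) (λ x → ℚP.0≤∣p∣ _)))

-- The final cross multiplication in ½ · (1/P) · (2D/M) ≤ M/n.
clear-denominators : ∀ D M n P → n * D ≤ P * M * M → 1 * (1 * (2 * D)) * n ≤ M * (2 * (P * M))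
clear-denominators D M n P n*D≤P*M*M = begin
  1 * (1 * (2 * D)) * n  ≡⟨ solve 2 (λ d n → con 1 :* (con 1 :* (con 2 :* d)) :* n := con 2 :* (n :* d)) refl D n ⟩
  2 * (n * D)            ≤⟨ ℕP.*-monoʳ-≤ 2 n*D≤P*M*M ⟩
  2 * (P * M * M)        ≡⟨ solve 2 (λ p m → con 2 :* (p :* m :* m) := m :* (con 2 :* (p :* m))) refl P M ⟩
  M * (2 * (P * M))      ∎
  where open ℕP.≤-Reasoning

module Distance {n : ℕ} (_∙_ : Op₂ (Fin n)) (ε : Fin n) (inv : Op₁ (Fin n))
                (isGroup : IsGroup _≡_ _∙_ ε inv) (r N : ℕ) where

  open Collisions _∙_ ε inv isGroup

  subsets : List (Subset N)
  subsets = subsetsOfSize N r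

  tuples : List (Vec (Fin n) N)
  tuples = allTuples N n

  M : ℕ
  M = length subsets

  m : Vec (Fin n) N → Fin n → ℕ
  m A = multiplicity _∙_ ε r A

  module _ (A : Vec (Fin n) N) where
    open Profile (allFin n) (m A) public
      using (support; collisions; profile-inequality)
      renaming (total to total-m; sum-of-squares to sum-of-squares-m)

  m-count : ∀ A x → m A x ≡ sumℕ subsets (λ I → 𝟙 (σ A I ≟ x))
  m-count A x = length-filter-𝟙 (λ I → σ A I ≟ x) subsets

  -- Every r-subset has exactly one sum.
  total-m≡M : ∀ A → total-m A ≡ M
  total-m≡M A = begin
    sumℕ (allFin n) (m A)                                       ≡⟨ sumℕ-cong (allFin n) (m-count A) ⟩
    sumℕ (allFin n) (λ x → sumℕ subsets (λ I → 𝟙 (σ A I ≟ x)))  ≡⟨ sumℕ-swap (allFin n) subsets _ ⟩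
    sumℕ subsets (λ I → sumℕ (allFin n) (λ x → 𝟙 (σ A I ≟ x)))  ≡⟨ sumℕ-cong subsets (λ I → sumFin-point n (σ A I)) ⟩
    sumℕ subsets (λ _ → 1)                                      ≡⟨ sumℕ-1 subsets ⟩
    M                                                           ∎
    where open ≡-Reasoning

  squares≡pairs : ∀ A → sumℕ (allFin n) (λ x → m A x * m A x)
                      ≡ sumℕ subsets (λ I → sumℕ subsets (λ J → 𝟙 (σ A J ≟ σ A I)))
  squares≡pairs A = begin
    sumℕ (allFin n) (λ x → m A x * m A x)
      ≡⟨ sumℕ-cong (allFin n) (λ x → trans (cong (_* m A x) (m-count A x)) (sym (sumℕ-*ʳ subsets _ (m A x)))) ⟩
    sumℕ (allFin n) (λ x → sumℕ subsets (λ I → 𝟙 (σ A I ≟ x) * m A x))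
      ≡⟨ sumℕ-swap (allFin n) subsets _ ⟩
    sumℕ subsets (λ I → sumℕ (allFin n) (λ x → 𝟙 (σ A I ≟ x) * m A x))
      ≡⟨ sumℕ-cong subsets (λ I → trans (sumFin-select n (σ A I) (m A)) (m-count A (σ A I))) ⟩
    sumℕ subsets (λ I → sumℕ subsets (λ J → 𝟙 (σ A J ≟ σ A I))) ∎
    where open ≡-Reasoning

  -- Averaged over A, the pairs with equal sums are the M diagonal pairs plus
  -- at most M² pairs of distinct subsets, each colliding with probability 1/n.
  pairs-average : n * sumℕ tuples (λ A → sumℕ (allFin n) (λ x → m A x * m A x)) ≤ (n ^ N * M + n * n ^ N) * M
  pairs-average = begin
    n * sumℕ tuples (λ A → sumℕ (allFin n) (λ x → m A x * m A x))
      ≡⟨ cong (n *_) (trans (sumℕ-cong tuples squares≡pairs)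
                     (trans (sumℕ-swap tuples subsets _) (sumℕ-cong subsets (λ I → sumℕ-swap tuples subsets _)))) ⟩
    n * sumℕ subsets (λ I → sumℕ subsets (λ J → collisionsOf J I))
      ≡⟨ trans (sym (sumℕ-*ˡ subsets n _)) (sumℕ-cong subsets (λ I → sym (sumℕ-*ˡ subsets n _))) ⟩
    sumℕ subsets (λ I → sumℕ subsets (λ J → n * collisionsOf J I))
      ≤⟨ sumℕ-mono subsets (λ I → sumℕ-mono subsets (λ J → collision-bound N J I)) ⟩
    sumℕ subsets (λ I → sumℕ subsets (λ J → n ^ N + sameSubset J I * (n * n ^ N)))
      ≡⟨ sumℕ-cong subsets (λ I → trans (sumℕ-+ subsets _ _)
                                         (cong₂ _+_ (sumℕ-const subsets (n ^ N)) (sumℕ-*ʳ subsets (λ J → sameSubset J I) _))) ⟩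
    sumℕ subsets (λ I → n ^ N * M + sumℕ subsets (λ J → sameSubset J I) * (n * n ^ N))
      ≤⟨ sumℕ-mono subsets (λ I → ℕP.+-monoʳ-≤ (n ^ N * M) (ℕP.*-monoˡ-≤ (n * n ^ N) (diagonal I))) ⟩
    sumℕ subsets (λ I → n ^ N * M + 1 * (n * n ^ N))
      ≡⟨ sumℕ-cong subsets (λ I → cong (_+_ (n ^ N * M)) (ℕP.*-identityˡ (n * n ^ N))) ⟩
    sumℕ subsets (λ I → n ^ N * M + n * n ^ N)
      ≡⟨ sumℕ-const subsets _ ⟩
    (n ^ N * M + n * n ^ N) * M ∎
    where
    open ℕP.≤-Reasoning
    diagonal : ∀ I → sumℕ subsets (λ J → sameSubset J I) ≤ 1
    diagonal I = ℕP.≤-trans (sumℕ-filter-≤ (λ J → ∣ J ∣ ℕ.≟ r) (allSubsets N) (λ J → sameSubset J I))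
                            (ℕP.≤-reflexive (sameSubset-count N I))

  collisions-average : n * sumℕ tuples collisions ≤ n ^ N * M * M
  collisions-average = ℕP.+-cancelʳ-≤ (n * (M * n ^ N)) (n * sumℕ tuples collisions) (n ^ N * M * M) (begin
    n * sumℕ tuples collisions + n * (M * n ^ N)
      ≡⟨ ℕP.*-distribˡ-+ n _ _ ⟨
    n * (sumℕ tuples collisions + M * n ^ N)
      ≡⟨ cong (λ z → n * (sumℕ tuples collisions + z))
              (trans (cong (M *_) (sym (count-tuples N n))) (sym (sumℕ-const tuples M))) ⟩
    n * (sumℕ tuples collisions + sumℕ tuples (λ _ → M))
      ≡⟨ cong (n *_) (sym (sumℕ-+ tuples collisions (λ _ → M))) ⟩
    n * sumℕ tuples (λ A → collisions A + M)
      ≡⟨ cong (n *_) (sumℕ-cong tuples (λ A → trans (cong (_+_ (collisions A)) (sym (total-m≡M A)))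
                                                   (sym (sum-of-squares-m A)))) ⟩
    n * sumℕ tuples (λ A → sumℕ (allFin n) (λ x → m A x * m A x))
      ≤⟨ pairs-average ⟩
    (n ^ N * M + n * n ^ N) * M
      ≡⟨ solve 3 (λ p m n → (p :* m :+ n :* p) :* m := p :* m :* m :+ n :* (m :* p)) refl (n ^ N) M n ⟩
    n ^ N * M * M + n * (M * n ^ N) ∎)
    where open ℕP.≤-Reasoning

  𝟙-inSums : ∀ A x → (if inSums _∙_ ε r A x then 1 else 0) ≡ 𝟙₊ (m A x)
  𝟙-inSums A x with multiplicity _∙_ ε r A x
  ... | zero  = refl
  ... | suc _ = refl

  numSums≡support : ∀ A → numSums _∙_ ε r A ≡ support A
  numSums≡support A = trans (length-filter-𝟙 (λ x → inSums _∙_ ε r A x Bool.≟ true) (allFin n))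
                            (sumℕ-cong (allFin n) per-point)
    where
    per-point : ∀ x → 𝟙 (inSums _∙_ ε r A x Bool.≟ true) ≡ 𝟙₊ (m A x)
    per-point x with multiplicity _∙_ ε r A x
    ... | zero  = refl
    ... | suc _ = refl

  m≤M : ∀ A x → m A x ≤ M
  m≤M A x = ListP.length-filter (λ I → σ A I ≟ x) subsets

  support-positive : ∀ A x → 0 < m A x → 0 < support A
  support-positive A x m>0 = ℕP.≤-trans (𝟙₊-pos m>0) (≤-sumFin n (λ y → 𝟙₊ (m A y)) x)
    where
    𝟙₊-pos : ∀ {k} → 0 < k → 0 < 𝟙₊ k
    𝟙₊-pos {suc k} _ = ℕP.≤-refl

  pointwise-distance : ∀ A x → ℚ.∣ prob₁ _∙_ ε r A x ℚ.- prob₂ _∙_ ε r A x ∣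
    ≡ frac 1 (n ^ N) ℚ.* frac ∣ m A x * support A - 𝟙₊ (m A x) * M ∣ (M * support A)
  pointwise-distance A x = begin
    ℚ.∣ p ℚ.* frac (m A x) M ℚ.- p ℚ.* frac (if inSums _∙_ ε r A x then 1 else 0) (numSums _∙_ ε r A) ∣
      ≡⟨ cong₂ (λ u v → ℚ.∣ p ℚ.* frac (m A x) M ℚ.- p ℚ.* frac u v ∣) (𝟙-inSums A x) (numSums≡support A) ⟩
    ℚ.∣ p ℚ.* frac (m A x) M ℚ.- p ℚ.* frac (𝟙₊ (m A x)) (support A) ∣
      ≡⟨ ∣*-*∣ p _ _ (frac-nonneg 1 (n ^ N)) ⟩
    p ℚ.* ℚ.∣ frac (m A x) M ℚ.- frac (𝟙₊ (m A x)) (support A) ∣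
      ≡⟨ cong (p ℚ.*_) (∣frac-frac𝟙₊∣ (m A x) M (support A) (m≤M A x) (support-positive A x)) ⟩
    p ℚ.* frac ∣ m A x * support A - 𝟙₊ (m A x) * M ∣ (M * support A) ∎
    where
    open ≡-Reasoning
    p = frac 1 (n ^ N)

  tuple-contribution : ∀ A →
    sumℚ (allFin n) (λ x → ℚ.∣ prob₁ _∙_ ε r A x ℚ.- prob₂ _∙_ ε r A x ∣)
      ℚ.≤ frac 1 (n ^ N) ℚ.* frac (2 * collisions A) M
  tuple-contribution A = begin
    sumℚ (allFin n) (λ x → ℚ.∣ prob₁ _∙_ ε r A x ℚ.- prob₂ _∙_ ε r A x ∣)
      ≡⟨ sumℚ-cong (allFin n) (pointwise-distance A) ⟩
    sumℚ (allFin n) (λ x → p ℚ.* frac (d x) (M * S))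
      ≡⟨ sumℚ-*ˡ (allFin n) p (λ x → frac (d x) (M * S)) ⟩
    p ℚ.* sumℚ (allFin n) (λ x → frac (d x) (M * S))
      ≡⟨ cong (p ℚ.*_) (sumℚ-frac (allFin n) d (M * S)) ⟩
    p ℚ.* frac (sumℕ (allFin n) d) (M * S)
      ≤⟨ *-monoˡ-≤-nonneg (frac-nonneg 1 (n ^ N)) (frac-cancel-≤ _ (2 * collisions A) M S Σd≤) ⟩
    p ℚ.* frac (2 * collisions A) M ∎
    where
    open ℚP.≤-Reasoning
    p = frac 1 (n ^ N)
    S = support A
    d : Fin n → ℕ
    d x = ∣ m A x * S - 𝟙₊ (m A x) * M ∣
    -- the profile inequality, with the total mass of m A being M
    Σd≤ : sumℕ (allFin n) d ≤ S * (2 * collisions A)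
    Σd≤ = ℕP.≤-trans (ℕP.≤-reflexive (sumℕ-cong (allFin n) (λ x →
                       cong (λ t → ∣ m A x * S - 𝟙₊ (m A x) * t ∣) (sym (total-m≡M A)))))
                     (profile-inequality A)

  statDist-≤ : .{{_ : ℕ.NonZero n}} → statDist n N _∙_ ε r ℚ.≤ frac M n
  statDist-≤ = begin
    statDist n N _∙_ ε r
      ≤⟨ *-monoˡ-≤-nonneg (frac-nonneg 1 2) (sumℚ-mono tuples tuple-contribution) ⟩
    frac 1 2 ℚ.* sumℚ tuples (λ A → p ℚ.* frac (2 * collisions A) M)
      ≡⟨ cong (frac 1 2 ℚ.*_) (trans (sumℚ-*ˡ tuples p (λ A → frac (2 * collisions A) M))
                                      (cong (p ℚ.*_) (sumℚ-frac tuples (λ A → 2 * collisions A) M))) ⟩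
    frac 1 2 ℚ.* (p ℚ.* frac (sumℕ tuples (λ A → 2 * collisions A)) M)
      ≡⟨ cong (λ z → frac 1 2 ℚ.* (p ℚ.* frac z M)) (sumℕ-*ˡ tuples 2 collisions) ⟩
    frac 1 2 ℚ.* (p ℚ.* frac (2 * D) M)
      ≡⟨ trans (cong (frac 1 2 ℚ.*_) (frac-* 1 (n ^ N) (2 * D) M)) (frac-* 1 2 (1 * (2 * D)) (n ^ N * M)) ⟩
    frac (1 * (1 * (2 * D))) (2 * (n ^ N * M))
      ≤⟨ frac-≤ (1 * (1 * (2 * D))) (2 * (n ^ N * M)) M n (clear-denominators D M n (n ^ N) collisions-average) ⟩
    frac M n ∎
    where
    open ℚP.≤-Reasoning
    p = frac 1 (n ^ N)
    D = sumℕ tuples collisions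

-- If N^(rq+p) ≤ n^q then (N^r)^(2q) · N^p ≤ n^(2q), i.e. (N^r/n)^(2q) · N^p ≤ 1.
exponent-bound : ∀ N n r q p → 1 ≤ N → N ^ (r * q + p) ≤ n ^ q → (N ^ r) ^ (2 * q) * N ^ p ≤ n ^ (2 * q) * 1
exponent-bound N n r q p N≥1 N^[rq+p]≤n^q = begin
  (N ^ r) ^ (2 * q) * N ^ p          ≡⟨ cong (_* N ^ p) (trans (ℕP.^-*-assoc N r (2 * q)) (cong (N ^_) rq-twice)) ⟩
  N ^ (r * q + r * q) * N ^ p        ≡⟨ cong (_* N ^ p) (ℕP.^-distribˡ-+-* N (r * q) (r * q)) ⟩
  N^rq * N^rq * N^p                  ≤⟨ ℕP.m≤m*n (N^rq * N^rq * N^p) N^p ⟩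
  N^rq * N^rq * N^p * N^p            ≡⟨ solve 2 (λ a b → a :* a :* b :* b := (a :* b) :* (a :* b)) refl N^rq N^p ⟩
  (N^rq * N^p) * (N^rq * N^p)        ≡⟨ cong₂ _*_ (ℕP.^-distribˡ-+-* N (r * q) p) (ℕP.^-distribˡ-+-* N (r * q) p) ⟨
  N ^ (r * q + p) * N ^ (r * q + p)  ≤⟨ ℕP.*-mono-≤ N^[rq+p]≤n^q N^[rq+p]≤n^q ⟩
  n ^ q * n ^ q                      ≡⟨ ℕP.^-distribˡ-+-* n q q ⟨
  n ^ (q + q)                        ≡⟨ cong (n ^_) (solve 1 (λ q → q :+ q := con 2 :* q) refl q) ⟩
  n ^ (2 * q)                        ≡⟨ ℕP.*-identityʳ (n ^ (2 * q)) ⟨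
  n ^ (2 * q) * 1                    ∎
  where
  open ℕP.≤-Reasoning
  N^rq = N ^ (r * q)
  N^p  = N ^ p
  rq-twice : r * (2 * q) ≡ r * q + r * q
  rq-twice = solve 2 (λ r q → r :* (con 2 :* q) := r :* q :+ r :* q) refl r q
  instance
    N^p≢0 : ℕ.NonZero N^p
    N^p≢0 = ℕ.>-nonZero (ℕP.m^n>0 N {{ℕ.>-nonZero N≥1}} p)

-- Lemma 5.10, with C = 1: in fact SD ≤ N^(k−1)/n ≤ N^(−c), c = p/q.
lemma5p10 : (k : ℕ) → 3 ≤ k → (p q : ℕ) → 0 < p → 0 < q →
    ∃[ C ] ((N : ℕ) → k ∸ 1 ≤ N →
    (n : ℕ) (_∙_ : Op₂ (Fin n)) (ε : Fin n) (inv : Op₁ (Fin n)) →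
    IsAbelianGroup _≡_ _∙_ ε inv →
    N ^ ((k ∸ 1) * q + p) ≤ n ^ q →
    (statDist n N _∙_ ε (k ∸ 1) ^ℚ (2 * q)) ℚ.* ((+ (N ^ p)) ℚ./ 1) ℚ.≤ C)
lemma5p10 k 3≤k p q _ _ = 1ℚ , bound
  where
  r = k ∸ 1
  bound : (N : ℕ) → r ≤ N → (n : ℕ) (_∙_ : Op₂ (Fin n)) (ε : Fin n) (inv : Op₁ (Fin n)) →
    IsAbelianGroup _≡_ _∙_ ε inv → N ^ (r * q + p) ≤ n ^ q →
    (statDist n N _∙_ ε r ^ℚ (2 * q)) ℚ.* frac (N ^ p) 1 ℚ.≤ 1ℚ
  -- the carrier Fin 0 has no neutral element
  bound N r≤N zero     _   ()  _   _              _
  bound N r≤N n@(suc _) _∙_ ε inv isAbelianGroup N^[rq+p]≤n^q = begin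
    statDist n N _∙_ ε r ^ℚ (2 * q) ℚ.* frac (N ^ p) 1
      ≤⟨ *-monoʳ-≤-nonneg (frac-nonneg (N ^ p) 1) (^-mono-≤ (2 * q) (statDist-nonneg n N _∙_ ε r) SD≤N^r/n) ⟩
    frac (N ^ r) n ^ℚ (2 * q) ℚ.* frac (N ^ p) 1
      ≡⟨ trans (cong (ℚ._* frac (N ^ p) 1) (frac-^ (N ^ r) n (2 * q))) (frac-* _ (n ^ (2 * q)) (N ^ p) 1) ⟩
    frac ((N ^ r) ^ (2 * q) * N ^ p) (n ^ (2 * q) * 1)
      ≤⟨ frac-≤-1 _ _ (exponent-bound N n r q p N≥1 N^[rq+p]≤n^q) ⟩
    1ℚ ∎
    where
    open ℚP.≤-Reasoning
    open Distance _∙_ ε inv (IsAbelianGroup.isGroup isAbelianGroup) r N using (M; statDist-≤)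
    -- N ≥ k − 1 ≥ 2
    N≥1 : 1 ≤ N
    N≥1 = ℕP.≤-trans (ℕP.∸-monoˡ-≤ 1 (ℕP.≤-trans (ℕP.n≤1+n 2) 3≤k)) r≤N
    SD≤N^r/n : statDist n N _∙_ ε r ℚ.≤ frac (N ^ r) n
    SD≤N^r/n = ℚP.≤-trans statDist-≤ (frac-≤ M n (N ^ r) n (ℕP.*-monoˡ-≤ n (#subsetsOfSize-≤ N r)))
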